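{- Define functions $S_k:\mathbb{Z}_{\ge0}\to\mathbb{Q}$ for $k\ge2$ recursively, together with $\tilde J_k(n)=\sum_{q=0}^n(-1)^q\binom{ -\frac12}{q}^{2}\binom nq S_k(q)$, by $S_2(p)=1$, $S_3(p)=-2\sum_{i=0}^{p-1}\frac{1}{(2i+1)^3}\binom{ -\frac12}{i}^{ -2}$, and for $k\ge4$ $$S_k(p)=\sum_{i=0}^{p-1}\frac{ -1}{(2i+1)^2}\binom{ -\frac12}{i}^{ -2}\sum_{j=0}^i(-1)^j\binom ij\tilde J_{k-2}(j+1).$$ Then for every $k\ge2$ and every $p\ge0$, $$S_{k+2}(p+1)-S_{k+2}(p)=\frac{S_k(p+1)}{(2p+2)^2}-\frac{S_k(p)}{(2p+1)^2}.$$
   Context: $\binom{ -1/2}{p}=\frac{(-1/2)(-1/2-1)\cdots(-1/2-p+1)}{p!}$ is the generalized binomial coefficient. The numbers $\tilde J_k(n)$ are the normalized higher Apéry-like numbers. -}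

module Defs where

open import Data.Nat using (ℕ; zero; suc; _!)
import Data.Nat as ℕ
open import Data.Nat.Combinatorics using (_C_)
open import Data.Integer using (+_)
open import Data.Rational using (ℚ; 0ℚ; 1ℚ; _+_; _*_; _-_; -_; _/_; 1/_; _≟_; ≢-nonZero)
open import Relation.Nullary using (yes; no)

ℕ→ℚ : ℕ → ℚ
ℕ→ℚ n = (+ n) / 1

-- total inverse: inv 0 = 0, otherwise the genuine reciprocal 1/x.
-- It is only ever applied to nonzero numbers below.
inv : ℚ → ℚ
inv x with x ≟ 0ℚ
... | yes _ = 0ℚ
... | no x≢0 = 1/_ x {{≢-nonZero x≢0}}

pow : ℚ → ℕ → ℚ
pow x zero = 1ℚ
pow x (suc n) = pow x n * x

sgn : ℕ → ℚ
sgn n = pow (- 1ℚ) n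

sumTo : ℕ → (ℕ → ℚ) → ℚ
sumTo zero f = 0ℚ
sumTo (suc n) f = sumTo n f + f n

falling : ℚ → ℕ → ℚ
falling a zero = 1ℚ
falling a (suc p) = falling a p * (a - ℕ→ℚ p)

gbinom : ℚ → ℕ → ℚ
gbinom a p = falling a p * inv (ℕ→ℚ (p !))

mhalf : ℚ
mhalf = - ((+ 1) / 2)

b2 : ℕ → ℚ
b2 q = gbinom mhalf q * gbinom mhalf q

Jof : (ℕ → ℚ) → ℕ → ℚ
Jof Sk n = sumTo (suc n) (λ q → sgn q * b2 q * ℕ→ℚ (n C q) * Sk q)

-- S k p = S_k(p) for k ≥ 2 (values for k = 0, 1 are unused junk, set to 0)
S : ℕ → ℕ → ℚ
S zero p = 0ℚ
S (suc zero) p = 0ℚ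
S (suc (suc zero)) p = 1ℚ
S (suc (suc (suc zero))) p =
  - (ℕ→ℚ 2) * sumTo p (λ i → inv (pow (ℕ→ℚ (2 ℕ.* i ℕ.+ 1)) 3) * inv (b2 i))
S (suc (suc (suc (suc k)))) p =
  sumTo p (λ i → (- 1ℚ) * inv (pow (ℕ→ℚ (2 ℕ.* i ℕ.+ 1)) 2) * inv (b2 i)
                 * sumTo (suc i) (λ j → sgn j * ℕ→ℚ (i C j) * Jof (S (suc (suc k))) (suc j)))

J : ℕ → ℕ → ℚ
J k = Jof (S k)

-- The difference S_{k+2}(p+1) - S_{k+2}(p) is the p-th summand of S_{k+2}, whose inner sum is an
-- alternating binomial sum of the values J̃_k(j+1).  Since J̃_k is the binomial transform of
-- q ↦ (-1)^q binom(-1/2,q)^2 S_k(q), Pascal's rule and binomial inversion collapse that inner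
-- sum to binom(-1/2,p)^2 S_k(p) - binom(-1/2,p+1)^2 S_k(p+1).  The theorem then follows from
-- the ratio binom(-1/2,p+1) / binom(-1/2,p) = -(2p+1)/(2p+2).
module Submission where

open import Defs
open import Data.Nat using (ℕ; zero; suc; _≤_; _+_; s≤s; _!)
import Data.Nat as ℕ
import Data.Nat.Properties as ℕP
open import Data.Nat.Combinatorics using (_C_; k>n⇒nCk≡0; nCk+nC[k+1]≡[n+1]C[k+1])
import Data.Nat.Coprimality as Coprimality
open import Data.Integer using (+_)
import Data.Integer as ℤ
import Data.Integer.Properties as ℤP
open import Data.Rational using (ℚ; mkℚ; 0ℚ; 1ℚ; -_; _*_; _-_; _/_; _≟_; ≢-nonZero; ↥_)
  renaming (_+_ to _⊕_)
open import Data.Rational.Properties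
  using ( +-*-commutativeRing; normalize-coprime; 1≢0; *-inverseˡ; *-zeroˡ; *-zeroʳ
        ; *-identityˡ; *-identityʳ; *-assoc; +-identityˡ; +-identityʳ; +-assoc
        ; *-distribˡ-+; *-distribʳ-+; neg-injective )
open import Data.Empty using (⊥-elim)
open import Relation.Nullary using (yes; no)
open import Relation.Nullary.Decidable using (dec⇒maybe)
open import Function using (_∘_)
open import Level using (0ℓ)
open import Relation.Binary.PropositionalEquality
  using (_≡_; _≢_; refl; sym; trans; cong; cong₂; module ≡-Reasoning)
open import Tactic.RingSolver using (solve-∀)
open import Tactic.RingSolver.Core.AlmostCommutativeRing
  using (AlmostCommutativeRing; fromCommutativeRing)

ℚ-ring : AlmostCommutativeRing 0ℓ 0ℓ
ℚ-ring = fromCommutativeRing +-*-commutativeRing (λ x → dec⇒maybe (0ℚ ≟ x))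

sumTo-cong : ∀ n {f g : ℕ → ℚ} → (∀ i → f i ≡ g i) → sumTo n f ≡ sumTo n g
sumTo-cong zero    f≡g = refl
sumTo-cong (suc n) f≡g = cong₂ _⊕_ (sumTo-cong n f≡g) (f≡g n)

sumTo-+ : ∀ n (f g : ℕ → ℚ) → sumTo n (λ i → f i ⊕ g i) ≡ sumTo n f ⊕ sumTo n g
sumTo-+ zero    f g = refl
sumTo-+ (suc n) f g =
  trans (cong (_⊕ (f n ⊕ g n)) (sumTo-+ n f g)) (interchange (sumTo n f) (f n) (sumTo n g) (g n))
  where
  interchange : ∀ a b c d → (a ⊕ c) ⊕ (b ⊕ d) ≡ (a ⊕ b) ⊕ (c ⊕ d)
  interchange = solve-∀ ℚ-ring

sumTo-*ˡ : ∀ n c (f : ℕ → ℚ) → sumTo n (λ i → c * f i) ≡ c * sumTo n f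
sumTo-*ˡ zero    c f = sym (*-zeroʳ c)
sumTo-*ˡ (suc n) c f =
  trans (cong (_⊕ c * f n) (sumTo-*ˡ n c f)) (sym (*-distribˡ-+ c (sumTo n f) (f n)))

sumTo-suc-head : ∀ n (f : ℕ → ℚ) → sumTo (suc n) f ≡ f 0 ⊕ sumTo n (f ∘ suc)
sumTo-suc-head zero    f = trans (+-identityˡ (f 0)) (sym (+-identityʳ (f 0)))
sumTo-suc-head (suc n) f =
  trans (cong (_⊕ f (suc n)) (sumTo-suc-head n f)) (+-assoc (f 0) (sumTo n (f ∘ suc)) (f (suc n)))

ℕ→ℚ-mkℚ : ∀ n → ℕ→ℚ n ≡ mkℚ (+ n) 0 (Coprimality.sym (Coprimality.1-coprimeTo n))
ℕ→ℚ-mkℚ n = normalize-coprime (Coprimality.sym (Coprimality.1-coprimeTo n))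

ℕ→ℚ-+ : ∀ m n → ℕ→ℚ (m ℕ.+ n) ≡ ℕ→ℚ m ⊕ ℕ→ℚ n
ℕ→ℚ-+ m n = sym (trans (cong₂ _⊕_ (ℕ→ℚ-mkℚ m) (ℕ→ℚ-mkℚ n)) (cong (_/ 1) numerator))
  where
  numerator : + m ℤ.* + 1 ℤ.+ + n ℤ.* + 1 ≡ + (m ℕ.+ n)
  numerator = trans (cong₂ ℤ._+_ (ℤP.*-identityʳ (+ m)) (ℤP.*-identityʳ (+ n))) (sym (ℤP.pos-+ m n))

ℕ→ℚ-* : ∀ m n → ℕ→ℚ (m ℕ.* n) ≡ ℕ→ℚ m * ℕ→ℚ n
ℕ→ℚ-* m n = sym (trans (cong₂ _*_ (ℕ→ℚ-mkℚ m) (ℕ→ℚ-mkℚ n)) (cong (_/ 1) (sym (ℤP.pos-* m n))))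

ℕ→ℚ-≢0 : ∀ n .{{_ : ℕ.NonZero n}} → ℕ→ℚ n ≢ 0ℚ
ℕ→ℚ-≢0 (suc n) n≡0 with cong ↥_ (trans (sym (ℕ→ℚ-mkℚ (suc n))) n≡0)
... | ()

inv-inverseˡ : ∀ {x} → x ≢ 0ℚ → inv x * x ≡ 1ℚ
inv-inverseˡ {x} x≢0 with x ≟ 0ℚ
... | yes x≡0 = ⊥-elim (x≢0 x≡0)
... | no  x≢0′ = *-inverseˡ x {{≢-nonZero x≢0′}}

inv-unique : ∀ {x w} → x * w ≡ 1ℚ → inv x ≡ w
inv-unique {x} {w} xw≡1 = begin
  inv x             ≡⟨ sym (*-identityʳ (inv x)) ⟩
  inv x * 1ℚ        ≡⟨ cong (inv x *_) (sym xw≡1) ⟩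
  inv x * (x * w)   ≡⟨ sym (*-assoc (inv x) x w) ⟩
  (inv x * x) * w   ≡⟨ cong (_* w) (inv-inverseˡ x≢0) ⟩
  1ℚ * w            ≡⟨ *-identityˡ w ⟩
  w                 ∎
  where
  open ≡-Reasoning
  x≢0 : x ≢ 0ℚ
  x≢0 x≡0 = 1≢0 (trans (sym xw≡1) (trans (cong (_* w) x≡0) (*-zeroˡ w)))

*-≢0 : ∀ {x y} → x ≢ 0ℚ → y ≢ 0ℚ → x * y ≢ 0ℚ
*-≢0 {x} {y} x≢0 y≢0 xy≡0 = x≢0 (begin
  x                   ≡⟨ sym (*-identityʳ x) ⟩
  x * 1ℚ              ≡⟨ cong (x *_) (sym (inv-inverseˡ y≢0)) ⟩
  x * (inv y * y)     ≡⟨ rearrange x (inv y) y ⟩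
  (x * y) * inv y     ≡⟨ cong (_* inv y) xy≡0 ⟩
  0ℚ * inv y          ≡⟨ *-zeroˡ (inv y) ⟩
  0ℚ                  ∎)
  where
  open ≡-Reasoning
  rearrange : ∀ a b c → a * (b * c) ≡ (a * c) * b
  rearrange = solve-∀ ℚ-ring

inv-ratio : ∀ {a b x y} → a ≢ 0ℚ → x ≢ 0ℚ → b * y ≡ a * x → inv x * inv a * b ≡ inv y
inv-ratio {a} {b} {x} {y} a≢0 x≢0 by≡ax = sym (inv-unique {y} (begin
  y * (inv x * inv a * b)     ≡⟨ pull-y y (inv x * inv a) b ⟩
  inv x * inv a * (b * y)     ≡⟨ cong (inv x * inv a *_) by≡ax ⟩
  inv x * inv a * (a * x)     ≡⟨ regroup (inv x) (inv a) a x ⟩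
  (inv x * x) * (inv a * a)   ≡⟨ cong₂ _*_ (inv-inverseˡ x≢0) (inv-inverseˡ a≢0) ⟩
  1ℚ * 1ℚ                     ≡⟨ *-identityˡ 1ℚ ⟩
  1ℚ                          ∎))
  where
  open ≡-Reasoning
  pull-y : ∀ y c b → y * (c * b) ≡ c * (b * y)
  pull-y = solve-∀ ℚ-ring
  regroup : ∀ u v a x → u * v * (a * x) ≡ (u * x) * (v * a)
  regroup = solve-∀ ℚ-ring

ℕ→ℚ-pascal : ∀ n k → ℕ→ℚ (suc n C suc k) ≡ ℕ→ℚ (n C k) ⊕ ℕ→ℚ (n C suc k)
ℕ→ℚ-pascal n k =
  trans (cong ℕ→ℚ (sym (nCk+nC[k+1]≡[n+1]C[k+1] n k))) (ℕ→ℚ-+ (n C k) (n C suc k))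

binomialSum : (ℕ → ℚ) → ℕ → ℚ
binomialSum f n = sumTo (suc n) (λ q → ℕ→ℚ (n C q) * f q)

alternate : (ℕ → ℚ) → ℕ → ℚ
alternate f q = sgn q * f q

binomialSum-cong : ∀ n {f g : ℕ → ℚ} → (∀ q → f q ≡ g q) → binomialSum f n ≡ binomialSum g n
binomialSum-cong n f≡g = sumTo-cong (suc n) (λ q → cong (ℕ→ℚ (n C q) *_) (f≡g q))

binomialSum-+ : ∀ n (f g : ℕ → ℚ) →
  binomialSum (λ q → f q ⊕ g q) n ≡ binomialSum f n ⊕ binomialSum g n
binomialSum-+ n f g =
  trans (sumTo-cong (suc n) (λ q → *-distribˡ-+ (ℕ→ℚ (n C q)) (f q) (g q))) (sumTo-+ (suc n) _ _)

binomialSum-*ˡ : ∀ n c (f : ℕ → ℚ) → binomialSum (λ q → c * f q) n ≡ c * binomialSum f n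
binomialSum-*ˡ n c f =
  trans (sumTo-cong (suc n) (λ q → swap (ℕ→ℚ (n C q)) c (f q))) (sumTo-*ˡ (suc n) c _)
  where
  swap : ∀ a c b → a * (c * b) ≡ c * (a * b)
  swap = solve-∀ ℚ-ring

binomialSum-suc : ∀ f n → binomialSum f (suc n) ≡ binomialSum f n ⊕ binomialSum (f ∘ suc) n
binomialSum-suc f n = begin
  binomialSum f (suc n)
    ≡⟨ sumTo-suc-head (suc n) _ ⟩
  1ℚ * f 0 ⊕ sumTo (suc n) (λ q → ℕ→ℚ (suc n C suc q) * f (suc q))
    ≡⟨ cong (1ℚ * f 0 ⊕_) (sumTo-cong (suc n) λ q →
         trans (cong (_* f (suc q)) (ℕ→ℚ-pascal n q)) (*-distribʳ-+ (f (suc q)) (ℕ→ℚ (n C q)) (ℕ→ℚ (n C suc q)))) ⟩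
  1ℚ * f 0 ⊕ sumTo (suc n) (λ q → ℕ→ℚ (n C q) * f (suc q) ⊕ upper q)
    ≡⟨ cong (1ℚ * f 0 ⊕_) (sumTo-+ (suc n) _ upper) ⟩
  1ℚ * f 0 ⊕ (binomialSum (f ∘ suc) n ⊕ (sumTo n upper ⊕ upper n))
    ≡⟨ cong (λ c → 1ℚ * f 0 ⊕ (binomialSum (f ∘ suc) n ⊕ (sumTo n upper ⊕ c * f (suc n))))
         (cong ℕ→ℚ (k>n⇒nCk≡0 (ℕP.n<1+n n))) ⟩
  1ℚ * f 0 ⊕ (binomialSum (f ∘ suc) n ⊕ (sumTo n upper ⊕ 0ℚ * f (suc n)))
    ≡⟨ rearrange (1ℚ * f 0) (binomialSum (f ∘ suc) n) (sumTo n upper) (f (suc n)) ⟩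
  (1ℚ * f 0 ⊕ sumTo n upper) ⊕ binomialSum (f ∘ suc) n
    ≡⟨ cong (_⊕ binomialSum (f ∘ suc) n) (sym (sumTo-suc-head n _)) ⟩
  binomialSum f n ⊕ binomialSum (f ∘ suc) n
    ∎
  where
  open ≡-Reasoning
  upper : ℕ → ℚ
  upper q = ℕ→ℚ (n C suc q) * f (suc q)
  rearrange : ∀ a b c d → a ⊕ (b ⊕ (c ⊕ 0ℚ * d)) ≡ (a ⊕ c) ⊕ b
  rearrange = solve-∀ ℚ-ring

sgn-sq : ∀ p → sgn p * sgn p ≡ 1ℚ
sgn-sq zero    = refl
sgn-sq (suc p) = trans (square (sgn p)) (cong (_* 1ℚ) (sgn-sq p))
  where
  square : ∀ s → s * - 1ℚ * (s * - 1ℚ) ≡ s * s * 1ℚ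
  square = solve-∀ ℚ-ring

binomial-inversion : ∀ f p → binomialSum (alternate (binomialSum f)) p ≡ sgn p * f p
binomial-inversion f zero = base (f 0)
  where
  base : ∀ a → 0ℚ ⊕ 1ℚ * (1ℚ * (0ℚ ⊕ 1ℚ * a)) ≡ 1ℚ * a
  base = solve-∀ ℚ-ring
binomial-inversion f (suc p) = begin
  binomialSum (alternate G) (suc p)
    ≡⟨ binomialSum-suc (alternate G) p ⟩
  binomialSum (alternate G) p ⊕ binomialSum (alternate G ∘ suc) p
    ≡⟨ cong (binomialSum (alternate G) p ⊕_) shifted ⟩
  binomialSum (alternate G) p ⊕ - 1ℚ * (binomialSum (alternate G) p ⊕ binomialSum (alternate G′) p)
    ≡⟨ cong₂ (λ u v → u ⊕ - 1ℚ * (u ⊕ v)) (binomial-inversion f p) (binomial-inversion (f ∘ suc) p) ⟩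
  sgn p * f p ⊕ - 1ℚ * (sgn p * f p ⊕ sgn p * f (suc p))
    ≡⟨ cancel (sgn p) (f p) (f (suc p)) ⟩
  sgn (suc p) * f (suc p)
    ∎
  where
  open ≡-Reasoning
  G G′ : ℕ → ℚ
  G  = binomialSum f
  G′ = binomialSum (f ∘ suc)
  distrib : ∀ s a b → s * - 1ℚ * (a ⊕ b) ≡ - 1ℚ * (s * a ⊕ s * b)
  distrib = solve-∀ ℚ-ring
  shifted : binomialSum (alternate G ∘ suc) p
            ≡ - 1ℚ * (binomialSum (alternate G) p ⊕ binomialSum (alternate G′) p)
  shifted = begin
    binomialSum (alternate G ∘ suc) p
      ≡⟨ binomialSum-cong p (λ j → trans (cong (sgn (suc j) *_) (binomialSum-suc f j))
                                         (distrib (sgn j) (G j) (G′ j))) ⟩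
    binomialSum (λ j → - 1ℚ * (alternate G j ⊕ alternate G′ j)) p
      ≡⟨ binomialSum-*ˡ p (- 1ℚ) _ ⟩
    - 1ℚ * binomialSum (λ j → alternate G j ⊕ alternate G′ j) p
      ≡⟨ cong (- 1ℚ *_) (binomialSum-+ p (alternate G) (alternate G′)) ⟩
    - 1ℚ * (binomialSum (alternate G) p ⊕ binomialSum (alternate G′) p)
      ∎
  cancel : ∀ s a b → s * a ⊕ - 1ℚ * (s * a ⊕ s * b) ≡ s * - 1ℚ * b
  cancel = solve-∀ ℚ-ring

binomial-inversion-suc : ∀ f p →
  binomialSum (alternate (binomialSum f ∘ suc)) p ≡ sgn p * (f p ⊕ f (suc p))
binomial-inversion-suc f p = begin
  binomialSum (alternate (binomialSum f ∘ suc)) p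
    ≡⟨ binomialSum-cong p (λ j → trans (cong (sgn j *_) (binomialSum-suc f j))
                                       (*-distribˡ-+ (sgn j) _ _)) ⟩
  binomialSum (λ j → alternate (binomialSum f) j ⊕ alternate (binomialSum (f ∘ suc)) j) p
    ≡⟨ binomialSum-+ p _ _ ⟩
  binomialSum (alternate (binomialSum f)) p ⊕ binomialSum (alternate (binomialSum (f ∘ suc))) p
    ≡⟨ cong₂ _⊕_ (binomial-inversion f p) (binomial-inversion (f ∘ suc) p) ⟩
  sgn p * f p ⊕ sgn p * f (suc p)
    ≡⟨ sym (*-distribˡ-+ (sgn p) (f p) (f (suc p))) ⟩
  sgn p * (f p ⊕ f (suc p))
    ∎
  where open ≡-Reasoning

gbinom-suc : ∀ a p → gbinom a (suc p) * ℕ→ℚ (suc p) ≡ gbinom a p * (a - ℕ→ℚ p)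
gbinom-suc a p = begin
  falling a p * (a - ℕ→ℚ p) * inv (ℕ→ℚ (suc p !)) * ℕ→ℚ (suc p)
    ≡⟨ *-assoc (falling a p * (a - ℕ→ℚ p)) _ _ ⟩
  falling a p * (a - ℕ→ℚ p) * (inv (ℕ→ℚ (suc p !)) * ℕ→ℚ (suc p))
    ≡⟨ cong (falling a p * (a - ℕ→ℚ p) *_) (sym (inv-unique {ℕ→ℚ (p !)} cancel-!)) ⟩
  falling a p * (a - ℕ→ℚ p) * inv (ℕ→ℚ (p !))
    ≡⟨ swap (falling a p) (a - ℕ→ℚ p) (inv (ℕ→ℚ (p !))) ⟩
  falling a p * inv (ℕ→ℚ (p !)) * (a - ℕ→ℚ p)
    ∎
  where
  open ≡-Reasoning
  swap : ∀ f d i → f * d * i ≡ f * i * d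
  swap = solve-∀ ℚ-ring
  pull : ∀ F i s → F * (i * s) ≡ i * (s * F)
  pull = solve-∀ ℚ-ring
  cancel-! : ℕ→ℚ (p !) * (inv (ℕ→ℚ (suc p !)) * ℕ→ℚ (suc p)) ≡ 1ℚ
  cancel-! = begin
    ℕ→ℚ (p !) * (inv (ℕ→ℚ (suc p !)) * ℕ→ℚ (suc p))
      ≡⟨ pull (ℕ→ℚ (p !)) (inv (ℕ→ℚ (suc p !))) (ℕ→ℚ (suc p)) ⟩
    inv (ℕ→ℚ (suc p !)) * (ℕ→ℚ (suc p) * ℕ→ℚ (p !))
      ≡⟨ cong (inv (ℕ→ℚ (suc p !)) *_) (sym (ℕ→ℚ-* (suc p) (p !))) ⟩
    inv (ℕ→ℚ (suc p !)) * ℕ→ℚ (suc p !)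
      ≡⟨ inv-inverseˡ (ℕ→ℚ-≢0 (suc p !) {{ℕP._!≢0 (suc p)}}) ⟩
    1ℚ
      ∎

module _ (p : ℕ) where
  private
    n two x y : ℚ
    n   = ℕ→ℚ p
    two = ℕ→ℚ 2
    x   = ℕ→ℚ (2 ℕ.* p ℕ.+ 1)
    y   = ℕ→ℚ (2 ℕ.* p ℕ.+ 2)

  ℕ→ℚ[2p+1]≢0 : x ≢ 0ℚ
  ℕ→ℚ[2p+1]≢0 = ℕ→ℚ-≢0 (2 ℕ.* p ℕ.+ 1) {{ℕ.≢-nonZero (ℕP.m+1+n≢0 (2 ℕ.* p))}}

  gbinom-mhalf-suc : gbinom mhalf (suc p) * y ≡ - (gbinom mhalf p * x)
  gbinom-mhalf-suc = begin
    g′ * y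
      ≡⟨ cong (g′ *_) (trans (ℕ→ℚ-+ (2 ℕ.* p) 2) (cong (_⊕ two) (ℕ→ℚ-* 2 p))) ⟩
    g′ * (two * n ⊕ two)
      ≡⟨ factor g′ two n ⟩
    two * (g′ * (1ℚ ⊕ n))
      ≡⟨ cong (two *_) (trans (cong (g′ *_) (sym (ℕ→ℚ-+ 1 p))) (gbinom-suc mhalf p)) ⟩
    two * (g * (mhalf - n))
      ≡⟨ expand two g mhalf n ⟩
    g * (two * mhalf) - g * (two * n)
      ≡⟨ finish g two n ⟩
    - (g * (two * n ⊕ 1ℚ))
      ≡⟨ cong (λ z → - (g * z)) (sym (trans (ℕ→ℚ-+ (2 ℕ.* p) 1) (cong (_⊕ 1ℚ) (ℕ→ℚ-* 2 p)))) ⟩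
    - (g * x)
      ∎
    where
    open ≡-Reasoning
    g g′ : ℚ
    g  = gbinom mhalf p
    g′ = gbinom mhalf (suc p)
    factor : ∀ g′ t n → g′ * (t * n ⊕ t) ≡ t * (g′ * (1ℚ ⊕ n))
    factor = solve-∀ ℚ-ring
    expand : ∀ t g m n → t * (g * (m - n)) ≡ g * (t * m) - g * (t * n)
    expand = solve-∀ ℚ-ring
    -- instantiated at t = ℕ→ℚ 2, where  t * mhalf  computes to  - 1ℚ
    finish : ∀ g t n → g * - 1ℚ - g * (t * n) ≡ - (g * (t * n ⊕ 1ℚ))
    finish = solve-∀ ℚ-ring

  b2-suc : b2 (suc p) * pow y 2 ≡ b2 p * pow x 2
  b2-suc = begin
    (g′ * g′) * (1ℚ * y * y)    ≡⟨ square g′ y ⟩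
    (g′ * y) * (g′ * y)         ≡⟨ cong₂ _*_ gbinom-mhalf-suc gbinom-mhalf-suc ⟩
    - (g * x) * - (g * x)       ≡⟨ neg-square g x ⟩
    (g * g) * (1ℚ * x * x)      ∎
    where
    open ≡-Reasoning
    g g′ : ℚ
    g  = gbinom mhalf p
    g′ = gbinom mhalf (suc p)
    square : ∀ a b → (a * a) * (1ℚ * b * b) ≡ (a * b) * (a * b)
    square = solve-∀ ℚ-ring
    neg-square : ∀ a b → - (a * b) * - (a * b) ≡ (a * a) * (1ℚ * b * b)
    neg-square = solve-∀ ℚ-ring

gbinom-mhalf-≢0 : ∀ p → gbinom mhalf p ≢ 0ℚ
gbinom-mhalf-≢0 zero    = 1≢0
gbinom-mhalf-≢0 (suc p) g′≡0 =
  *-≢0 (gbinom-mhalf-≢0 p) (ℕ→ℚ[2p+1]≢0 p) (neg-injective (begin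
    - (gbinom mhalf p * ℕ→ℚ (2 ℕ.* p ℕ.+ 1))    ≡⟨ sym (gbinom-mhalf-suc p) ⟩
    gbinom mhalf (suc p) * y                   ≡⟨ cong (_* y) g′≡0 ⟩
    0ℚ * y                                     ≡⟨ *-zeroˡ y ⟩
    - 0ℚ                                       ∎))
  where
  open ≡-Reasoning
  y : ℚ
  y = ℕ→ℚ (2 ℕ.* p ℕ.+ 2)

b2-ratio : ∀ p → inv (pow (ℕ→ℚ (2 ℕ.* p ℕ.+ 1)) 2) * inv (b2 p) * b2 (suc p)
                 ≡ inv (pow (ℕ→ℚ (2 ℕ.* p ℕ.+ 2)) 2)
b2-ratio p = inv-ratio (*-≢0 g≢0 g≢0) (*-≢0 (*-≢0 1≢0 (ℕ→ℚ[2p+1]≢0 p)) (ℕ→ℚ[2p+1]≢0 p)) (b2-suc p)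
  where
  g≢0 : gbinom mhalf p ≢ 0ℚ
  g≢0 = gbinom-mhalf-≢0 p

Jof-binomialSum : ∀ Sk n → Jof Sk n ≡ binomialSum (alternate (λ q → b2 q * Sk q)) n
Jof-binomialSum Sk n = sumTo-cong (suc n) (λ q → regroup (sgn q) (b2 q) (ℕ→ℚ (n C q)) (Sk q))
  where
  regroup : ∀ s b c v → s * b * c * v ≡ c * (s * (b * v))
  regroup = solve-∀ ℚ-ring

alternating-Jof-suc : ∀ Sk p →
  sumTo (suc p) (λ j → sgn j * ℕ→ℚ (p C j) * Jof Sk (suc j))
    ≡ b2 p * Sk p - b2 (suc p) * Sk (suc p)
alternating-Jof-suc Sk p = begin
  sumTo (suc p) (λ j → sgn j * ℕ→ℚ (p C j) * Jof Sk (suc j))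
    ≡⟨ sumTo-cong (suc p) (λ j → trans (cong (sgn j * ℕ→ℚ (p C j) *_) (Jof-binomialSum Sk (suc j)))
                                       (swap (sgn j) (ℕ→ℚ (p C j)) _)) ⟩
  binomialSum (alternate (binomialSum (alternate w) ∘ suc)) p
    ≡⟨ binomial-inversion-suc (alternate w) p ⟩
  sgn p * (sgn p * w p ⊕ sgn p * - 1ℚ * w (suc p))
    ≡⟨ factor (sgn p) (w p) (w (suc p)) ⟩
  sgn p * sgn p * (w p - w (suc p))
    ≡⟨ cong (_* (w p - w (suc p))) (sgn-sq p) ⟩
  1ℚ * (w p - w (suc p))
    ≡⟨ *-identityˡ _ ⟩
  w p - w (suc p)
    ∎
  where
  open ≡-Reasoning
  w : ℕ → ℚ
  w q = b2 q * Sk q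
  swap : ∀ s c v → s * c * v ≡ c * (s * v)
  swap = solve-∀ ℚ-ring
  factor : ∀ s a b → s * (s * a ⊕ s * - 1ℚ * b) ≡ s * s * (a - b)
  factor = solve-∀ ℚ-ring

S-difference : ∀ m p →
  S (4 ℕ.+ m) (suc p) - S (4 ℕ.+ m) p
    ≡ S (2 ℕ.+ m) (suc p) * inv (pow (ℕ→ℚ (2 ℕ.* p ℕ.+ 2)) 2)
      - S (2 ℕ.+ m) p * inv (pow (ℕ→ℚ (2 ℕ.* p ℕ.+ 1)) 2)
S-difference m p = begin
  (S (4 ℕ.+ m) p ⊕ - 1ℚ * ix * inv (b2 p) * inner) - S (4 ℕ.+ m) p
    ≡⟨ add-sub (S (4 ℕ.+ m) p) _ ⟩
  - 1ℚ * ix * inv (b2 p) * inner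
    ≡⟨ cong (- 1ℚ * ix * inv (b2 p) *_) (alternating-Jof-suc Sk p) ⟩
  - 1ℚ * ix * inv (b2 p) * (b2 p * Sk p - b2 (suc p) * Sk (suc p))
    ≡⟨ expand ix (inv (b2 p)) (b2 p) (b2 (suc p)) (Sk p) (Sk (suc p)) ⟩
  Sk (suc p) * (ix * inv (b2 p) * b2 (suc p)) - Sk p * ix * (inv (b2 p) * b2 p)
    ≡⟨ cong₂ (λ u v → Sk (suc p) * u - Sk p * ix * v)
             (b2-ratio p) (inv-inverseˡ (*-≢0 (gbinom-mhalf-≢0 p) (gbinom-mhalf-≢0 p))) ⟩
  Sk (suc p) * iy - Sk p * ix * 1ℚ
    ≡⟨ cong (λ v → Sk (suc p) * iy - v) (*-identityʳ (Sk p * ix)) ⟩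
  Sk (suc p) * iy - Sk p * ix
    ∎
  where
  open ≡-Reasoning
  Sk : ℕ → ℚ
  Sk = S (2 ℕ.+ m)
  ix iy inner : ℚ
  ix    = inv (pow (ℕ→ℚ (2 ℕ.* p ℕ.+ 1)) 2)
  iy    = inv (pow (ℕ→ℚ (2 ℕ.* p ℕ.+ 2)) 2)
  inner = sumTo (suc p) (λ j → sgn j * ℕ→ℚ (p C j) * Jof Sk (suc j))
  add-sub : ∀ a d → (a ⊕ d) - a ≡ d
  add-sub = solve-∀ ℚ-ring
  expand : ∀ i j b b′ A B → - 1ℚ * i * j * (b * A - b′ * B) ≡ B * (i * j * b′) - A * i * (j * b)
  expand = solve-∀ ℚ-ring

mainTheorem6 : (k p : ℕ) → 2 ≤ k →
    S (k + 2) (suc p) - S (k + 2) p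
      ≡ S k (suc p) * inv (pow (ℕ→ℚ (2 ℕ.* p ℕ.+ 2)) 2)
        - S k p * inv (pow (ℕ→ℚ (2 ℕ.* p ℕ.+ 1)) 2)
mainTheorem6 (suc (suc m)) p (s≤s (s≤s _)) rewrite ℕP.+-comm m 2 = S-difference m p
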